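{- Let $I$ be an independent set of a tree $T$ such that the token on every vertex of $I$ is $(T,I)$-movable, and let $v$ be a vertex of $T$ with $v\notin I$. Then there is at most one neighbor $w\in I\cap N_T(v)$ such that the token on $w$ is $(T^v_w, I\cap V(T^v_w))$-rigid.
   Context: For a graph $G$ and independent sets $I,J$ of $G$, $I\leftrightarrow J$ means there is an edge $\{x,y\}\in E(G)$ with $I\setminus J=\{x\}$ and $J\setminus I=\{y\}$. Write $I\rightsquigarrow_G J$ if there is a sequence $I=I_1,\dots,I_\ell=J$ of independent sets of $G$ with $I_{i-1}\leftrightarrow I_i$ for all $i$. $N_G(x)$ is the neighborhood of $x$. For a tree $T$ and distinct vertices $a,b$, $T^a_b$ is the subtree consisting of $b$ and its descendants when $T$ is rooted at $a$. For a subtree $T'$ of $T$ and an independent set $I$ of $T$, the token on $x\in I\cap V(T')$ is $(T', I\cap V(T'))$-rigid if $x\in J$ for every independent set $J$ of $T'$ with $I\cap V(T')\rightsquigarrow_{T'} J$, and $(T', I\cap V(T'))$-movable otherwise; $T'=T$ gives $(T,I)$-rigid/movable. -}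

module Defs where

open import Data.Nat using (ℕ; _≤_)
open import Data.Fin using (Fin)
open import Data.Fin.Subset using (Subset; _∈_; _∉_)
open import Data.Bool using (Bool; true; false; T)
open import Data.List using (List; head; last; length)
open import Data.Maybe using (just)
open import Data.List.Relation.Unary.Linked using (Linked)
open import Data.List.Relation.Unary.Unique.Propositional using (Unique)
import Data.List.Membership.Propositional as LM
open import Data.Product using (Σ; ∃; _×_)
open import Data.Unit using (⊤)
open import Relation.Nullary using (¬_)
open import Relation.Binary.PropositionalEquality using (_≡_; _≢_)
open import Relation.Binary.Construct.Closure.ReflexiveTransitive using (Star)
open import Function.Bundles using (_⇔_)

record Graph (n : ℕ) : Set where
  field
    adj    : Fin n → Fin n → Bool
    sym    : ∀ x y → adj x y ≡ adj y x
    irrefl : ∀ x → adj x x ≡ false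

module _ {n : ℕ} (G : Graph n) where
  open Graph G

  Adj : Fin n → Fin n → Set
  Adj x y = T (adj x y)

  IsPath : Fin n → Fin n → List (Fin n) → Set
  IsPath a b ps = Linked Adj ps × Unique ps × head ps ≡ just a × last ps ≡ just b

  IsCycle : List (Fin n) → Set
  IsCycle cs = 3 ≤ length cs × Linked Adj cs × Unique cs ×
               Σ (Fin n) λ a → Σ (Fin n) λ b → head cs ≡ just a × last cs ≡ just b × Adj b a

  IsTree : Set
  IsTree = (∀ a b → ∃ λ ps → IsPath a b ps) × ¬ (∃ λ cs → IsCycle cs)

  -- vertex set of T^a_b : b and its descendants when rooted at a, i.e. the
  -- vertices x such that b lies on the (unique) path from a to x.
  SubtreeV : Fin n → Fin n → Fin n → Set
  SubtreeV a b x = ∃ λ ps → IsPath a x ps × b LM.∈ ps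

  AllV : Fin n → Set
  AllV _ = ⊤

  -- Below, S : Fin n → Set is the vertex set of an induced subgraph (subtree) T' of G.
  -- I is an independent set of T'
  Indep : (Fin n → Set) → Subset n → Set
  Indep S I = (∀ x → x ∈ I → S x) × (∀ x y → x ∈ I → y ∈ I → ¬ Adj x y)

  Slide : (Fin n → Set) → Subset n → Subset n → Set
  Slide S I J = Σ (Fin n) λ x → Σ (Fin n) λ y →
    Adj x y × S x × S y ×
    (∀ z → (z ∈ I × z ∉ J) ⇔ (z ≡ x)) ×
    (∀ z → (z ∈ J × z ∉ I) ⇔ (z ≡ y))

  SlideStep : (Fin n → Set) → Subset n → Subset n → Set
  SlideStep S I J = Indep S I × Indep S J × Slide S I J

  Reach : (Fin n → Set) → Subset n → Subset n → Set
  Reach S = Star (SlideStep S)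

  IsRestriction : (Fin n → Set) → Subset n → Subset n → Set
  IsRestriction S I I' = ∀ z → z ∈ I' ⇔ (z ∈ I × S z)

  Rigid : (Fin n → Set) → Subset n → Fin n → Set
  Rigid S I x = ∀ I' J → IsRestriction S I I' → Indep S J → Reach S I' J → x ∈ J

  Movable : (Fin n → Set) → Subset n → Fin n → Set
  Movable S I x = ¬ Rigid S I x

-- If two distinct neighbours w₁, w₂ of v both had rigid tokens in their branches T^v_w,
-- then along any reconfiguration sequence of T starting at I both tokens would stay put.
-- A slide with both ends in a branch restricts to a slide inside that branch, which
-- cannot move its rigid token; a slide with one end in the branch and the other outside
-- must use v, since v is the only vertex outside T^v_w adjacent to it, and a token on v
-- would be adjacent to w₁ or to w₂, both still occupied; any other slide leaves the
-- branch untouched. So the token on w₁ would be (T,I)-rigid, contrary to assumption.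
module Submission where

open import Defs
open import Data.Nat using (ℕ; zero; suc)
open import Data.Fin using (Fin; _≟_)
import Data.Fin as Fin
open import Data.Fin.Subset using (Subset; _∈_; _∉_; _∩_; _⊆_)
open import Data.Fin.Subset.Properties using (_∈?_; x∈p∩q⁺; x∈p∩q⁻; ⊆-antisym)
open import Data.Bool using (T)
open import Data.List using (List; []; _∷_; _++_; [_]; head; last)
open import Data.List.Relation.Unary.Linked using (Linked; [-]; _∷_)
import Data.List.Relation.Unary.Linked.Properties as Linked
open import Data.List.Relation.Unary.AllPairs using ([]; _∷_)
open import Data.List.Relation.Unary.All as All using ([])
open import Data.List.Relation.Unary.All.Properties using (¬Any⇒All¬)
open import Data.List.Relation.Unary.Any using (here; there)
open import Data.List.Membership.Propositional using () renaming (_∈_ to _∈ₗ_; _∉_ to _∉ₗ_)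
open import Data.List.Membership.Propositional.Properties using (∈-++⁻)
open import Data.List.Relation.Binary.Subset.Propositional using () renaming (_⊆_ to _⊆ₗ_)
open import Data.Maybe using (just)
open import Data.Maybe.Relation.Binary.Connected using (Connected; just)
open import Data.Product using (∃; _×_; _,_; proj₁; proj₂)
open import Data.Sum using (_⊎_; inj₁; inj₂; [_,_]′)
open import Data.Unit using (tt)
open import Data.Empty using (⊥-elim)
open import Data.Vec using (tabulate)
open import Data.Vec.Properties using (lookup∘tabulate; []=⇒lookup; lookup⇒[]=)
open import Function using (_∘_)
open import Function.Bundles using (_⇔_; mk⇔; Equivalence)
open import Relation.Nullary using (¬_; Dec; yes; no; does)
open import Relation.Nullary.Decidable using (dec-true; ¬¬-excluded-middle)
open import Relation.Binary.PropositionalEquality using (_≡_; _≢_; refl; sym; trans; subst)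
open import Relation.Binary.Construct.Closure.ReflexiveTransitive using (ε; _◅_; _◅◅_)

open Equivalence using (to; from)

¬¬-decidable : ∀ {n} (P : Fin n → Set) → ¬ ¬ (∀ x → Dec (P x))
¬¬-decidable {zero}  P k = k λ ()
¬¬-decidable {suc n} P k =
  ¬¬-excluded-middle λ P0? → ¬¬-decidable (P ∘ Fin.suc) λ Psuc? →
    k λ { Fin.zero → P0? ; (Fin.suc x) → Psuc? x }

module _ {n} {P : Fin n → Set} (P? : ∀ x → Dec (P x)) where

  toSubset : Subset n
  toSubset = tabulate (does ∘ P?)

  ∈-toSubset⁺ : ∀ {x} → P x → x ∈ toSubset
  ∈-toSubset⁺ {x} px = lookup⇒[]= x _ (trans (lookup∘tabulate (does ∘ P?) x) (dec-true (P? x) px))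

  ∈-toSubset⁻ : ∀ {x} → x ∈ toSubset → P x
  ∈-toSubset⁻ {x} x∈ with P? x | trans (sym (lookup∘tabulate (does ∘ P?) x)) ([]=⇒lookup x∈)
  ... | yes px | _ = px

last-++-[_] : ∀ {A : Set} (y : A) xs → last (xs ++ [ y ]) ≡ just y
last-++-[ y ] []           = refl
last-++-[ y ] (x ∷ [])     = refl
last-++-[ y ] (x ∷ x′ ∷ xs) = last-++-[ y ] (x′ ∷ xs)

module _ {n : ℕ} where

  _∖_≐⁅_⁆ : Subset n → Subset n → Fin n → Set
  J ∖ K ≐⁅ x ⁆ = ∀ z → (z ∈ J × z ∉ K) ⇔ (z ≡ x)

  ∖≐-∈ : ∀ {J K x} → J ∖ K ≐⁅ x ⁆ → x ∈ J
  ∖≐-∈ {x = x} J∖K = proj₁ (from (J∖K x) refl)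

  ∖≐-∉ : ∀ {J K x} → J ∖ K ≐⁅ x ⁆ → x ∉ K
  ∖≐-∉ {x = x} J∖K = proj₂ (from (J∖K x) refl)

  ∖≐-stays : ∀ {J K x z} → J ∖ K ≐⁅ x ⁆ → z ∈ J → z ≢ x → z ∈ K
  ∖≐-stays {K = K} {z = z} J∖K z∈J z≢x with z ∈? K
  ... | yes z∈K = z∈K
  ... | no z∉K  = ⊥-elim (z≢x (to (J∖K z) (z∈J , z∉K)))

  ∖≐-one-stays : ∀ {J K x w u} → w ≢ u → J ∖ K ≐⁅ x ⁆ → w ∈ J → u ∈ J → w ∈ K ⊎ u ∈ K
  ∖≐-one-stays {x = x} {w} w≢u J∖K w∈J u∈J with w ≟ x
  ... | yes refl = inj₂ (∖≐-stays J∖K u∈J (w≢u ∘ sym))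
  ... | no w≢x   = inj₁ (∖≐-stays J∖K w∈J w≢x)

module _ {n : ℕ} (G : Graph n) where
  open import Data.List.Membership.DecPropositional (_≟_ {n}) using () renaming (_∈?_ to _∈ₗ?_)

  Adj-sym : ∀ {x y} → Adj G x y → Adj G y x
  Adj-sym {x} {y} = subst T (Graph.sym G x y)

  Adj⇒≢ : ∀ {x y} → Adj G x y → x ≢ y
  Adj⇒≢ {x} xy refl = subst T (Graph.irrefl G x) xy

  IsWalk : Fin n → Fin n → List (Fin n) → Set
  IsWalk a b ws = Linked (Adj G) ws × head ws ≡ just a × last ws ≡ just b

  IsPath⇒IsWalk : ∀ {a b ps} → IsPath G a b ps → IsWalk a b ps
  IsPath⇒IsWalk (L , _ , h , l) = L , h , l

  IsWalk-snoc : ∀ {a b c} ws → IsWalk a b ws → Adj G b c → IsWalk a c (ws ++ [ c ])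
  IsWalk-snoc {c = c} (a ∷ ws) (L , refl , l) bc =
    Linked.++⁺ L (subst (λ m → Connected (Adj G) m (just c)) (sym l) (just bc)) [-] ,
    refl , last-++-[ c ] (a ∷ ws)

  source∈ : ∀ {a b ps} → IsPath G a b ps → a ∈ₗ ps
  source∈ {ps = _ ∷ _} (_ , _ , refl , _) = here refl

  IsPath-∷ : ∀ {a a′ b qs} → Adj G a a′ → a ∉ₗ qs → IsPath G a′ b qs → IsPath G a b (a ∷ qs)
  IsPath-∷ {qs = _ ∷ _} aa′ a∉qs (L , U , refl , l) = aa′ ∷ L , ¬Any⇒All¬ _ a∉qs ∷ U , refl , l

  IsPath-suffix : ∀ {a b w} ps → IsPath G a b ps → w ∈ₗ ps →
                  ∃ λ rs → IsPath G w b rs × rs ⊆ₗ ps × (a ≢ w → a ∉ₗ rs)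
  IsPath-suffix (p ∷ ps) P@(_ , _ , refl , _) (here refl) = p ∷ ps , P , (λ z∈ → z∈) , λ a≢a → ⊥-elim (a≢a refl)
  IsPath-suffix (p ∷ q ∷ ps) (_ ∷ L , p∉ ∷ U , refl , l) (there w∈)
    with IsPath-suffix (q ∷ ps) (L , U , refl , l) w∈
  ... | rs , R , rs⊆ , _ = rs , R , (λ z∈ → there (rs⊆ z∈)) , λ _ p∈rs → All.lookup p∉ (rs⊆ p∈rs) refl

  walk⇒path : ∀ {a b} ws → IsWalk a b ws → ∃ λ ps → IsPath G a b ps × ps ⊆ₗ ws
  walk⇒path (a ∷ []) (_ , refl , refl) = a ∷ [] , ([-] , [] ∷ [] , refl , refl) , λ z∈ → z∈
  walk⇒path (a ∷ a′ ∷ ws) (aa′ ∷ L , refl , l) with walk⇒path (a′ ∷ ws) (L , refl , l)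
  ... | qs , Q , qs⊆ with a ∈ₗ? qs
  ...   | yes a∈qs = let rs , R , rs⊆ , _ = IsPath-suffix qs Q a∈qs in
                     rs , R , λ z∈ → there (qs⊆ (rs⊆ z∈))
  ...   | no a∉qs  = a ∷ qs , IsPath-∷ aa′ a∉qs Q , λ { (here e) → here e ; (there z∈) → there (qs⊆ z∈) }

  SubtreeV-child : ∀ {v w} → Adj G v w → SubtreeV G v w w
  SubtreeV-child {v} {w} vw =
    v ∷ w ∷ [] , IsPath-∷ vw (λ { (here v≡w) → Adj⇒≢ vw v≡w }) ([-] , [] ∷ [] , refl , refl) , there (here refl)

  SubtreeV-exit : ∀ {v w x y} → Adj G v w → SubtreeV G v w x → Adj G x y → ¬ SubtreeV G v w y → y ≡ v
  SubtreeV-exit {v} {w} {x} {y} vw (ps , P , w∈ps) xy y∉ with y ≟ v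
  ... | yes y≡v = y≡v
  ... | no y≢v with IsPath-suffix ps P w∈ps
  ...   | rs , R , _ , v∉rs with walk⇒path (rs ++ [ y ]) (IsWalk-snoc rs (IsPath⇒IsWalk R) xy)
  ...     | qs , Q , qs⊆ = ⊥-elim (y∉ (v ∷ qs , IsPath-∷ vw v∉qs Q , there (source∈ Q)))
    where
    v∉qs : v ∉ₗ qs
    v∉qs v∈qs with ∈-++⁻ rs (qs⊆ v∈qs)
    ... | inj₁ v∈rs       = v∉rs (Adj⇒≢ vw) v∈rs
    ... | inj₂ (here v≡y) = y≢v (sym v≡y)

  restriction-AllV : ∀ {I I′} → IsRestriction G (AllV G) I I′ → I′ ≡ I
  restriction-AllV I′-restr =
    ⊆-antisym (λ z∈ → proj₁ (to (I′-restr _) z∈)) (λ z∈ → from (I′-restr _) (z∈ , tt))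

  module _ {S : Fin n → Set} (S? : ∀ z → Dec (S z)) where
    private
      S̃ = toSubset S?

    ∩-restriction : ∀ J → IsRestriction G S J (J ∩ S̃)
    ∩-restriction J z = mk⇔
      (λ z∈ → let z∈J , z∈S̃ = x∈p∩q⁻ J S̃ z∈ in z∈J , ∈-toSubset⁻ S? z∈S̃)
      (λ (z∈J , sz) → x∈p∩q⁺ (z∈J , ∈-toSubset⁺ S? sz))

    Indep-∩ : ∀ {J} → Indep G (AllV G) J → Indep G S (J ∩ S̃)
    Indep-∩ {J} (_ , independent) =
      (λ z z∈ → proj₂ (to (∩-restriction J z) z∈)) ,
      (λ x y x∈ y∈ → independent x y (proj₁ (x∈p∩q⁻ J S̃ x∈)) (proj₁ (x∈p∩q⁻ J S̃ y∈)))

    ∖≐-∩ : ∀ {J K x} → J ∖ K ≐⁅ x ⁆ → S x → (J ∩ S̃) ∖ (K ∩ S̃) ≐⁅ x ⁆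
    ∖≐-∩ {J} {K} {x} J∖K sx z = mk⇔
      (λ (z∈J∩S̃ , z∉K∩S̃) → let z∈J , z∈S̃ = x∈p∩q⁻ J S̃ z∈J∩S̃ in
        to (J∖K z) (z∈J , λ z∈K → z∉K∩S̃ (x∈p∩q⁺ (z∈K , z∈S̃))))
      (λ { refl → x∈p∩q⁺ (∖≐-∈ J∖K , ∈-toSubset⁺ S? sx) ,
                  λ x∈K∩S̃ → ∖≐-∉ J∖K (proj₁ (x∈p∩q⁻ K S̃ x∈K∩S̃)) })

    ∖≐-∩-⊆ : ∀ {J K x} → J ∖ K ≐⁅ x ⁆ → ¬ S x → J ∩ S̃ ⊆ K ∩ S̃
    ∖≐-∩-⊆ {J} J∖K ¬sx z∈ =
      let z∈J , z∈S̃ = x∈p∩q⁻ J S̃ z∈ in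
      x∈p∩q⁺ (∖≐-stays J∖K z∈J (λ { refl → ¬sx (∈-toSubset⁻ S? z∈S̃) }) , z∈S̃)

  module _ {v w u} (I : Subset n) (w≢u : w ≢ u) (vw : Adj G v w) (vu : Adj G v u)
           (S? : ∀ z → Dec (SubtreeV G v w z)) (rigid : Rigid G (SubtreeV G v w) I w) where
    private
      S = SubtreeV G v w
      S̃ = toSubset S?

    rigid-child-stays : ∀ {J K} → SlideStep G (AllV G) J K → w ∈ J → u ∈ J →
                        Reach G S (I ∩ S̃) (J ∩ S̃) → w ∈ K × Reach G S (I ∩ S̃) (K ∩ S̃)
    rigid-child-stays {J} {K} (indJ , indK , x , y , xy , _ , _ , J∖K , K∖J) w∈J u∈J trace
      with S? x | S? y
    ... | yes sx | yes sy = proj₁ (x∈p∩q⁻ K S̃ w∈K∩S̃) , trace′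
      where
      trace′ : Reach G S (I ∩ S̃) (K ∩ S̃)
      trace′ = trace ◅◅ ((Indep-∩ S? indJ , Indep-∩ S? indK , x , y , xy , sx , sy ,
                          ∖≐-∩ S? J∖K sx , ∖≐-∩ S? K∖J sy) ◅ ε)
      w∈K∩S̃ : w ∈ K ∩ S̃
      w∈K∩S̃ = rigid (I ∩ S̃) (K ∩ S̃) (∩-restriction S? I) (Indep-∩ S? indK) trace′
    ... | yes sx | no ¬sy =
      ⊥-elim ([ (λ w∈K → proj₂ indK v w v∈K w∈K vw) , (λ u∈K → proj₂ indK v u v∈K u∈K vu) ]′
                (∖≐-one-stays w≢u J∖K w∈J u∈J))
      where
      v∈K : v ∈ K
      v∈K = subst (_∈ K) (SubtreeV-exit vw sx xy ¬sy) (∖≐-∈ K∖J)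
    ... | no ¬sx | yes sy = ⊥-elim (proj₂ indJ v w v∈J w∈J vw)
      where
      v∈J : v ∈ J
      v∈J = subst (_∈ J) (SubtreeV-exit vw sy (Adj-sym xy) ¬sx) (∖≐-∈ J∖K)
    ... | no ¬sx | no ¬sy =
      ∖≐-stays J∖K w∈J (λ { refl → ¬sx (SubtreeV-child vw) }) ,
      subst (Reach G S (I ∩ S̃)) (⊆-antisym (∖≐-∩-⊆ S? J∖K ¬sx) (∖≐-∩-⊆ S? K∖J ¬sy)) trace

  rigid-siblings⇒rigid : ∀ {v w₁ w₂} (I : Subset n) → w₁ ≢ w₂ → Adj G v w₁ → Adj G v w₂ →
    (S₁? : ∀ z → Dec (SubtreeV G v w₁ z)) (S₂? : ∀ z → Dec (SubtreeV G v w₂ z)) →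
    Rigid G (SubtreeV G v w₁) I w₁ → Rigid G (SubtreeV G v w₂) I w₂ →
    w₁ ∈ I → w₂ ∈ I → Rigid G (AllV G) I w₁
  rigid-siblings⇒rigid {v} {w₁} {w₂} I w₁≢w₂ vw₁ vw₂ S₁? S₂? rigid₁ rigid₂ w₁∈I w₂∈I I′ J I′-restr _ reach =
    proj₁ (preserved (w₁∈I , w₂∈I , ε , ε) (subst (λ I₀ → Reach G (AllV G) I₀ J) (restriction-AllV I′-restr) reach))
    where
    Invariant : Subset n → Set
    Invariant K = w₁ ∈ K × w₂ ∈ K ×
                  Reach G (SubtreeV G v w₁) (I ∩ toSubset S₁?) (K ∩ toSubset S₁?) ×
                  Reach G (SubtreeV G v w₂) (I ∩ toSubset S₂?) (K ∩ toSubset S₂?)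
    preserved : ∀ {K L} → Invariant K → Reach G (AllV G) K L → Invariant L
    preserved inv ε = inv
    preserved (w₁∈K , w₂∈K , trace₁ , trace₂) (step ◅ steps) =
      let w₁∈K′ , trace₁′ = rigid-child-stays I w₁≢w₂ vw₁ vw₂ S₁? rigid₁ step w₁∈K w₂∈K trace₁
          w₂∈K′ , trace₂′ = rigid-child-stays I (w₁≢w₂ ∘ sym) vw₂ vw₁ S₂? rigid₂ step w₂∈K w₁∈K trace₂
      in preserved (w₁∈K′ , w₂∈K′ , trace₁′ , trace₂′) steps

-- Membership in T^v_w is only decided under a double negation, which is harmless since the
-- goal follows from absurdity once w₁ ≢ w₂.
lemma2 : (n : ℕ) (T : Graph n) → IsTree T →
         (I : Subset n) → Indep T (AllV T) I →
         (∀ x → x ∈ I → Movable T (AllV T) I x) →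
         (v : Fin n) → v ∉ I →
         (w₁ w₂ : Fin n) →
         w₁ ∈ I → Adj T v w₁ → Rigid T (SubtreeV T v w₁) I w₁ →
         w₂ ∈ I → Adj T v w₂ → Rigid T (SubtreeV T v w₂) I w₂ →
         w₁ ≡ w₂
lemma2 n T _ I _ movable v _ w₁ w₂ w₁∈I vw₁ rigid₁ w₂∈I vw₂ rigid₂ with w₁ ≟ w₂
... | yes w₁≡w₂ = w₁≡w₂
... | no w₁≢w₂ =
  ⊥-elim (¬¬-decidable (SubtreeV T v w₁) λ S₁? → ¬¬-decidable (SubtreeV T v w₂) λ S₂? →
    movable w₁ w₁∈I (rigid-siblings⇒rigid T I w₁≢w₂ vw₁ vw₂ S₁? S₂? rigid₁ rigid₂ w₁∈I w₂∈I))
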